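{- In a $\frac32$-institution, let $\varphi_k:(\Sigma_0,E_0)\to(\Sigma_k,E_k)$, $k=1,2$, be a span of weak (resp. strong) theory morphisms; let $\theta_k:\Sigma_k\to\Sigma$, $k=0,1,2$, be a lax cocone for the underlying span of signature morphisms; let $\gamma_k:\Sigma_k\to\Sigma$ be as follows: $\gamma_k=\theta_k$ in the weak case, and in the strong case any signature morphisms with $\theta_k\le\gamma_k$ and $\mathit{Sen}(\gamma_k)$ total; and let $E\subseteq\mathit{Sen}(\Sigma)$ satisfy $\bigcup_{k}\mathit{Sen}(\gamma_k)E_k^\bullet\subseteq E^\bullet$, so that $\theta_k:(\Sigma_k,E_k)\to(\Sigma,E)$ form a lax cocone of weak (resp. strong) theory morphisms. Let $\mathcal T\subseteq\mathit{Sign}$ be a (1-)subcategory, and let $\mathcal T_w$ (resp. $\mathcal T_s$) denote the class of weak (resp. strong) theory morphisms whose underlying signature morphism lies in $\mathcal T$. Assume further that $\mathit{Mod}$ does not admit emptiness, that $(\theta_0,\theta_1,\theta_2)$ is a lax $\mathcal T$-pushout of signature morphisms, and that $E^\bullet=\big(\bigcup_{k=0,1,2}\mathit{Sen}(\gamma_k)E_k^\bullet\big)^\bullet$. Then the lax cocone of theory morphisms $(\theta_0,\theta_1,\theta_2)$: (a) in the weak case, is a lax $\mathcal T_w$-pushout when $\mathit{Sen}$ is lax (hence strict) and every signature morphism in $\mathcal T$ is $\mathit{Sen}$-maximal; (b) in the strong case, is a lax $\mathcal T_s$-pushout when every signature morphism in $\mathcal T$ is $\mathit{Mod}$-maxi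mal.
   Context: A $\frac32$-institution $(\mathit{Sign},\mathit{Sen},\mathit{Mod},\models)$: a category $\mathit{Sign}$ with partially ordered hom-sets and monotone (diagrammatic) composition; for each signature $\Sigma$ a set $\mathit{Sen}(\Sigma)$ and for each $\varphi:\Sigma\to\Sigma'$ a partial function $\mathit{Sen}(\varphi)$, monotone in $\varphi$ and either lax ($\mathit{Sen}(\varphi);\mathit{Sen}(\varphi')\subseteq\mathit{Sen}(\varphi;\varphi')$, $1\subseteq\mathit{Sen}(1_\Sigma)$) or oplax (reverse inclusions); strict = both; for each $\Sigma$ a category $\mathit{Mod}(\Sigma)$ and for each $\varphi$ a lax functor assigning each $\operatorname{cod}\varphi$-model $M'$ a set $\mathit{Mod}(\varphi)M'$ of $\operatorname{dom}\varphi$-models, with $\varphi\le\theta\Rightarrow\mathit{Mod}(\theta)M'\subseteq\mathit{Mod}(\varphi)M'$, $\bigcup_{M'\in\mathit{Mod}(\varphi')M''}\mathit{Mod}(\varphi)M'\subseteq\mathit{Mod}(\varphi;\varphi')M''$, $M\in\mathit{Mod}(1_\Sigma)M$; satisfaction relations with the Satisfaction Condition ($M'\models\mathit{Sen}(\varphi)\rho$ iff $M\models\rho$ for $M\in\mathit{Mod}(\varphi)M'$, $\rho\in\mathrm{dom}\,\mathit{Sen}(\varphi)$). Whenever weak theory morphisms are used, $\mathit{Sen}$ is assumed oplax. $\mathit{Mod}$ does not admit emptiness if $\mathit{Mod}(\varphi)M'\neq\emptyset$ always. $\varphi$ is $\mathit{Sen}$-maximal if $\mathit{Sen}(\varphi)$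 is total, $\mathit{Mod}$-maximal if every $\mathit{Mod}(\varphi)M'$ is a singleton. Theories, $E^\bullet$ (sentences satisfied by all models of $E$), weak theory morphisms ($\mathit{Sen}(\varphi)E^\bullet\subseteq E'^\bullet$) and strong ones (every $M'\models E'$ has some $M\in\mathit{Mod}(\varphi)M'$ with $M\models E$) inherit order and composition from $\mathit{Sign}$. For a span $\varphi_1,\varphi_2$ with common domain and a class $\mathcal C$ of arrows closed under composition: a lax cocone is $(\theta_0,\theta_1,\theta_2)$ with common codomain and $\varphi_k;\theta_k\le\theta_0$; a lax $\mathcal C$-pushout is a lax cocone with components in $\mathcal C$ such that for every lax cocone $\theta'$ with components in $\mathcal C$ there is a unique $\mu\in\mathcal C$ with $\theta_k;\mu=\theta'_k$, $k=0,1,2$. -}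

module Defs where

open import Level using (Level; suc; _⊔_)
open import Data.Maybe using (Maybe; just)
open import Data.Product using (Σ; Σ-syntax; ∃; ∃-syntax; _×_; _,_)
open import Data.Sum using (_⊎_)
open import Relation.Binary.PropositionalEquality using (_≡_)

Pred : ∀ {a} → Set a → (ℓ : Level) → Set (a ⊔ suc ℓ)
Pred A ℓ = A → Set ℓ

_⊆_ : ∀ {a ℓ} {A : Set a} → Pred A ℓ → Pred A ℓ → Set (a ⊔ ℓ)
P ⊆ Q = ∀ x → P x → Q x

-- graph inclusion of partial functions (represented Maybe-valued)
_⊑_ : ∀ {a b} {A : Set a} {B : Set b} → (A → Maybe B) → (A → Maybe B) → Set (a ⊔ b)
f ⊑ g = ∀ x y → f x ≡ just y → g x ≡ just y

_⨾ₚ_ : ∀ {a b c} {A : Set a} {B : Set b} {C : Set c} →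
       (A → Maybe B) → (B → Maybe C) → (A → Maybe C)
(f ⨾ₚ g) x = Data.Maybe._>>=_ (f x) g

-- Categories with partially ordered hom-sets and monotone composition
-- (composition written diagrammatically:  f ⨾ g  means first f then g)

record OrdCat (ℓ : Level) : Set (suc ℓ) where
  infixr 9 _⨾_
  infix 4 _≤_
  field
    Obj  : Set ℓ
    Hom  : Obj → Obj → Set ℓ
    id   : ∀ {A} → Hom A A
    _⨾_  : ∀ {A B C} → Hom A B → Hom B C → Hom A C
    idˡ  : ∀ {A B} (f : Hom A B) → id ⨾ f ≡ f
    idʳ  : ∀ {A B} (f : Hom A B) → f ⨾ id ≡ f
    assoc : ∀ {A B C D} (f : Hom A B) (g : Hom B C) (h : Hom C D) →
            (f ⨾ g) ⨾ h ≡ f ⨾ (g ⨾ h)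
    _≤_  : ∀ {A B} → Hom A B → Hom A B → Set ℓ
    ≤-refl  : ∀ {A B} {f : Hom A B} → f ≤ f
    ≤-trans : ∀ {A B} {f g h : Hom A B} → f ≤ g → g ≤ h → f ≤ h
    ≤-antisym : ∀ {A B} {f g : Hom A B} → f ≤ g → g ≤ f → f ≡ g
    ⨾-mono : ∀ {A B C} {f f' : Hom A B} {g g' : Hom B C} →
             f ≤ f' → g ≤ g' → f ⨾ g ≤ f' ⨾ g'

record Inst (ℓ : Level) : Set (suc ℓ) where
  field
    Sig : OrdCat ℓ
  open OrdCat Sig public
  field
    Sen    : Obj → Set ℓ
    sen    : ∀ {Σ₁ Σ₂} → Hom Σ₁ Σ₂ → Sen Σ₁ → Maybe (Sen Σ₂)
    sen-mono : ∀ {Σ₁ Σ₂} {φ θ : Hom Σ₁ Σ₂} → φ ≤ θ → sen φ ⊑ sen θ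
    Mod    : Obj → Set ℓ
    mod    : ∀ {Σ₁ Σ₂} → Hom Σ₁ Σ₂ → Mod Σ₂ → Pred (Mod Σ₁) ℓ
    mod-mono : ∀ {Σ₁ Σ₂} {φ θ : Hom Σ₁ Σ₂} → φ ≤ θ →
               ∀ M' → mod θ M' ⊆ mod φ M'
    mod-comp : ∀ {Σ₁ Σ₂ Σ₃} (φ : Hom Σ₁ Σ₂) (φ' : Hom Σ₂ Σ₃) M'' M' M →
               mod φ' M'' M' → mod φ M' M → mod (φ ⨾ φ') M'' M
    mod-id : ∀ {Σ₀} (M : Mod Σ₀) → mod id M M
    _⊨_    : ∀ {Σ₀} → Mod Σ₀ → Sen Σ₀ → Set ℓ
    satisfaction : ∀ {Σ₁ Σ₂} (φ : Hom Σ₁ Σ₂) (M' : Mod Σ₂) (M : Mod Σ₁) →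
                   mod φ M' M → ∀ ρ ρ' → sen φ ρ ≡ just ρ' →
                   ((M' ⊨ ρ' → M ⊨ ρ) × (M ⊨ ρ → M' ⊨ ρ'))

  SenLax : Set ℓ
  SenLax = (∀ {Σ₁ Σ₂ Σ₃} (φ : Hom Σ₁ Σ₂) (φ' : Hom Σ₂ Σ₃) →
              (sen φ ⨾ₚ sen φ') ⊑ sen (φ ⨾ φ'))
         × (∀ {Σ₀} → just ⊑ sen (id {Σ₀}))

  SenOplax : Set ℓ
  SenOplax = (∀ {Σ₁ Σ₂ Σ₃} (φ : Hom Σ₁ Σ₂) (φ' : Hom Σ₂ Σ₃) →
                sen (φ ⨾ φ') ⊑ (sen φ ⨾ₚ sen φ'))
           × (∀ {Σ₀} → sen (id {Σ₀}) ⊑ just)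

  field
    senLaxity : SenLax ⊎ SenOplax

module Notions {ℓ} (I : Inst ℓ) where
  open Inst I

  _⊨*_ : ∀ {Σ₀} → Mod Σ₀ → Pred (Sen Σ₀) ℓ → Set ℓ
  M ⊨* E = ∀ e → E e → M ⊨ e

  _• : ∀ {Σ₀} → Pred (Sen Σ₀) ℓ → Pred (Sen Σ₀) ℓ
  (E •) ρ = ∀ M → M ⊨* E → M ⊨ ρ

  SenImg : ∀ {Σ₁ Σ₂} → Hom Σ₁ Σ₂ → Pred (Sen Σ₁) ℓ → Pred (Sen Σ₂) ℓ
  SenImg φ P ρ' = ∃[ ρ ] (P ρ × sen φ ρ ≡ just ρ')

  _∪₃_∪₃_ : ∀ {A : Set ℓ} → Pred A ℓ → Pred A ℓ → Pred A ℓ → Pred A ℓ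
  (P ∪₃ Q ∪₃ R) x = P x ⊎ Q x ⊎ R x

  _≐_ : ∀ {A : Set ℓ} → Pred A ℓ → Pred A ℓ → Set ℓ
  P ≐ Q = (P ⊆ Q) × (Q ⊆ P)

  Theory : Set (suc ℓ)
  Theory = Σ[ Σ₀ ∈ Obj ] Pred (Sen Σ₀) ℓ

  sig : Theory → Obj
  sig (Σ₀ , _) = Σ₀

  ax : (T : Theory) → Pred (Sen (sig T)) ℓ
  ax (_ , E) = E

  IsWeak : ∀ (T T' : Theory) → Hom (sig T) (sig T') → Set ℓ
  IsWeak T T' φ = SenImg φ (ax T •) ⊆ (ax T' •)

  IsStrong : ∀ (T T' : Theory) → Hom (sig T) (sig T') → Set ℓ
  IsStrong T T' φ = ∀ M' → M' ⊨* ax T' → ∃[ M ] (mod φ M' M × M ⊨* ax T)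

  ModNonEmpty : Set ℓ
  ModNonEmpty = ∀ {Σ₁ Σ₂} (φ : Hom Σ₁ Σ₂) (M' : Mod Σ₂) → ∃[ M ] mod φ M' M

  SenTotal : ∀ {Σ₁ Σ₂} → Hom Σ₁ Σ₂ → Set ℓ
  SenTotal φ = ∀ ρ → ∃[ ρ' ] (sen φ ρ ≡ just ρ')

  SenMaximal = SenTotal

  ModMaximal : ∀ {Σ₁ Σ₂} → Hom Σ₁ Σ₂ → Set ℓ
  ModMaximal φ = ∀ M' → ∃[ M ] (mod φ M' M × (∀ N → mod φ M' N → N ≡ M))

record Subcat {ℓ} (C : OrdCat ℓ) : Set (suc ℓ) where
  open OrdCat C
  field
    ObjIn : Obj → Set ℓ
    In    : ∀ {A B} → Hom A B → Set ℓ
    dom-in : ∀ {A B} {f : Hom A B} → In f → ObjIn A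
    cod-in : ∀ {A B} {f : Hom A B} → In f → ObjIn B
    id-in  : ∀ {A} → ObjIn A → In (id {A})
    ⨾-in   : ∀ {A B C} {f : Hom A B} {g : Hom B C} → In f → In g → In (f ⨾ g)

module LaxPO {o h c : Level} (Ob : Set o) (Hm : Ob → Ob → Set h)
             (_⨾_ : ∀ {A B C} → Hm A B → Hm B C → Hm A C)
             (_≤_ : ∀ {A B} → Hm A B → Hm A B → Set h)
             (Cl : ∀ {A B} → Hm A B → Set c) where

  IsLaxCocone : ∀ {A₀ A₁ A₂ B} (φ₁ : Hm A₀ A₁) (φ₂ : Hm A₀ A₂)
                (θ₀ : Hm A₀ B) (θ₁ : Hm A₁ B) (θ₂ : Hm A₂ B) → Set h
  IsLaxCocone φ₁ φ₂ θ₀ θ₁ θ₂ = ((φ₁ ⨾ θ₁) ≤ θ₀) × ((φ₂ ⨾ θ₂) ≤ θ₀)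

  IsLaxPushout : ∀ {A₀ A₁ A₂ B} (φ₁ : Hm A₀ A₁) (φ₂ : Hm A₀ A₂)
                 (θ₀ : Hm A₀ B) (θ₁ : Hm A₁ B) (θ₂ : Hm A₂ B) →
                 Set (o ⊔ h ⊔ c)
  IsLaxPushout {A₀} {A₁} {A₂} {B} φ₁ φ₂ θ₀ θ₁ θ₂ =
      IsLaxCocone φ₁ φ₂ θ₀ θ₁ θ₂
    × Cl θ₀ × Cl θ₁ × Cl θ₂
    × (∀ (B' : Ob) (θ₀' : Hm A₀ B') (θ₁' : Hm A₁ B') (θ₂' : Hm A₂ B') →
         IsLaxCocone φ₁ φ₂ θ₀' θ₁' θ₂' → Cl θ₀' → Cl θ₁' → Cl θ₂' →
         Σ[ μ ∈ Hm B B' ] ((Cl μ × (θ₀ ⨾ μ) ≡ θ₀' × (θ₁ ⨾ μ) ≡ θ₁' × (θ₂ ⨾ μ) ≡ θ₂')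
           × (∀ (ν : Hm B B') → Cl ν → (θ₀ ⨾ ν) ≡ θ₀' → (θ₁ ⨾ ν) ≡ θ₁' →
                (θ₂ ⨾ ν) ≡ θ₂' → ν ≡ μ)))

-- Instantiations: lax pushouts of signature morphisms (class 𝒯) and of
-- weak / strong theory morphisms (classes 𝒯_w / 𝒯_s).  Theory morphisms
-- inherit order and composition from Sign.

module Pushouts {ℓ} (I : Inst ℓ) (𝒯 : Subcat (Inst.Sig I)) where
  open Inst I
  open Notions I
  open Subcat 𝒯

  module SigPO = LaxPO Obj Hom _⨾_ _≤_ In

  ThHom : Theory → Theory → Set ℓ
  ThHom T T' = Hom (sig T) (sig T')

  𝒯w : ∀ {T T'} → ThHom T T' → Set ℓ
  𝒯w {T} {T'} φ = In φ × IsWeak T T' φ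

  𝒯s : ∀ {T T'} → ThHom T T' → Set ℓ
  𝒯s {T} {T'} φ = In φ × IsStrong T T' φ

  module WeakPO   = LaxPO Theory ThHom _⨾_ _≤_ (λ {T} {T'} → 𝒯w {T} {T'})
  module StrongPO = LaxPO Theory ThHom _⨾_ _≤_ (λ {T} {T'} → 𝒯s {T} {T'})

module Submission where

-- The signature-level lax 𝒯-pushout already provides, for every
-- cocone of theory morphisms, a unique mediating signature morphism μ in 𝒯;
-- uniqueness transfers verbatim, since theory morphisms are just signature
-- morphisms with a property.  So the theorem reduces to two facts about the
-- property (weak, resp. strong):
--   * the legs θₖ : (Σₖ , Eₖ) → (Σ , E) have it, and
--   * the mediator μ : (Σ , E) → (Σ' , E') has it whenever every θₖ ⨾ μ has.
-- Both are argued through models: if every μ-reduct M of a model M' of E'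
-- satisfies the generators U = ⋃ₖ Sen(γₖ)(Eₖ•) of E•, then μ is weak/strong
-- (using that Mod admits no emptiness).  That every reduct satisfies
-- Sen(γₖ)(Eₖ•) follows from θₖ ⨾ μ being weak (via laxity of Sen and
-- Sen-maximality of μ) resp. strong (via Mod-maximality of θₖ ⨾ μ).

open import Defs
open import Data.Product using (_×_; _,_; proj₁; proj₂)
open import Data.Maybe using (Maybe; just)
open import Data.Sum using (inj₁; inj₂)
open import Relation.Binary.PropositionalEquality using (_≡_; sym; trans; subst)

⨾ₚ-just : ∀ {a b c} {A : Set a} {B : Set b} {C : Set c}
  (f : A → Maybe B) (g : B → Maybe C) {x y z} →
  f x ≡ just y → g y ≡ just z → (f ⨾ₚ g) x ≡ just z
⨾ₚ-just f g fx≡y gy≡z rewrite fx≡y = gy≡z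

module InstitutionFacts {ℓ} (I : Inst ℓ) where
  open Inst I
  open Notions I

  ⊆-• : ∀ {Σ₀} (E : Pred (Sen Σ₀) ℓ) → E ⊆ (E •)
  ⊆-• E e e∈E M M⊨E = M⊨E e e∈E

  ∪₃-⊆ : ∀ {A : Set ℓ} {P Q R S : Pred A ℓ} → (P ∪₃ Q ∪₃ R) ⊆ S → (P ⊆ S) × (Q ⊆ S) × (R ⊆ S)
  ∪₃-⊆ PQR⊆S = (λ x x∈P → PQR⊆S x (inj₁ x∈P)) , (λ x x∈Q → PQR⊆S x (inj₂ (inj₁ x∈Q)))
             , (λ x x∈R → PQR⊆S x (inj₂ (inj₂ x∈R)))

  ReductsSatisfy : ∀ {Σ₁ Σ₂} → Hom Σ₁ Σ₂ → Pred (Sen Σ₂) ℓ → Pred (Sen Σ₁) ℓ → Set ℓ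
  ReductsSatisfy μ E' U = ∀ M' → M' ⊨* E' → ∀ M → mod μ M' M → M ⊨* U

  reducts-∪₃ : ∀ {Σ₁ Σ₂} {μ : Hom Σ₁ Σ₂} {E' : Pred (Sen Σ₂) ℓ} {P Q R : Pred (Sen Σ₁) ℓ} →
    ReductsSatisfy μ E' P → ReductsSatisfy μ E' Q → ReductsSatisfy μ E' R →
    ReductsSatisfy μ E' (P ∪₃ Q ∪₃ R)
  reducts-∪₃ p q r M' M'⊨E' M M∈ e (inj₁ e∈P)        = p M' M'⊨E' M M∈ e e∈P
  reducts-∪₃ p q r M' M'⊨E' M M∈ e (inj₂ (inj₁ e∈Q)) = q M' M'⊨E' M M∈ e e∈Q
  reducts-∪₃ p q r M' M'⊨E' M M∈ e (inj₂ (inj₂ e∈R)) = r M' M'⊨E' M M∈ e e∈R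

  -- If the reducts satisfy generators U of E•, then μ is a weak theory
  -- morphism: a translated consequence of E holds in M' because it holds
  -- in some (existing) reduct of M'.
  weak-by-reducts : ModNonEmpty → ∀ {Σ₁ Σ₂} (μ : Hom Σ₁ Σ₂)
    {E U : Pred (Sen Σ₁) ℓ} {E' : Pred (Sen Σ₂) ℓ} →
    (E •) ⊆ (U •) → ReductsSatisfy μ E' U → IsWeak (Σ₁ , E) (Σ₂ , E') μ
  weak-by-reducts ne μ E•⊆U• reducts⊨U ρ' (ρ , ρ∈E• , μρ≡ρ') M' M'⊨E' =
    let (M , M∈) = ne μ M'
    in proj₂ (satisfaction μ M' M M∈ ρ ρ' μρ≡ρ')
             (E•⊆U• ρ ρ∈E• M (reducts⊨U M' M'⊨E' M M∈))

  -- Likewise μ is a strong theory morphism: any reduct is a model of E.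
  strong-by-reducts : ModNonEmpty → ∀ {Σ₁ Σ₂} (μ : Hom Σ₁ Σ₂)
    {E U : Pred (Sen Σ₁) ℓ} {E' : Pred (Sen Σ₂) ℓ} →
    (E •) ⊆ (U •) → ReductsSatisfy μ E' U → IsStrong (Σ₁ , E) (Σ₂ , E') μ
  strong-by-reducts ne μ {E} E•⊆U• reducts⊨U M' M'⊨E' =
    let (M , M∈) = ne μ M'
    in M , M∈ , λ e e∈E → E•⊆U• e (⊆-• E e e∈E) M (reducts⊨U M' M'⊨E' M M∈)

  strong-reduct : ∀ {Σ₁ Σ₂} {E : Pred (Sen Σ₁) ℓ} {E' : Pred (Sen Σ₂) ℓ}
    (φ : Hom Σ₁ Σ₂) → ModMaximal φ → IsStrong (Σ₁ , E) (Σ₂ , E') φ →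
    ∀ M' → M' ⊨* E' → ∀ N → mod φ M' N → N ⊨* E
  strong-reduct {E = E} φ maximal strong M' M'⊨E' N N∈ =
    let (M , M∈ , M⊨E) = strong M' M'⊨E'
        (_ , _ , unique) = maximal M'
    in subst (_⊨* E) (trans (unique M M∈) (sym (unique N N∈))) M⊨E

  -- Weak case: if θ ⨾ μ is weak and Sen(μ) is total, laxity of Sen shows
  -- that Sen(μ) maps Sen(θ)(Eₖ•) into E'•, so reducts satisfy Sen(θ)(Eₖ•).
  weak-transport : SenLax → ∀ {Σₖ Σ Σ'} {Eₖ : Pred (Sen Σₖ) ℓ} {E' : Pred (Sen Σ') ℓ}
    (θ : Hom Σₖ Σ) (μ : Hom Σ Σ') → SenTotal μ →
    IsWeak (Σₖ , Eₖ) (Σ' , E') (θ ⨾ μ) → ReductsSatisfy μ E' (SenImg θ (Eₖ •))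
  weak-transport (lax-⨾ , _) θ μ μ-total θμ-weak M' M'⊨E' M M∈ ρ (ρₖ , ρₖ∈ , θρₖ≡ρ) =
    let (ρ' , μρ≡ρ') = μ-total ρ
        θμρₖ≡ρ' = lax-⨾ θ μ ρₖ ρ' (⨾ₚ-just (sen θ) (sen μ) θρₖ≡ρ μρ≡ρ')
    in proj₁ (satisfaction μ M' M M∈ ρ ρ' μρ≡ρ')
             (θμ-weak ρ' (ρₖ , ρₖ∈ , θμρₖ≡ρ') M' M'⊨E')

  -- Strong case: a γ-reduct Mₖ of a μ-reduct M of M' is also a (θ ⨾ μ)-reduct
  -- of M' (as θ ≤ γ), hence the unique one, hence a model of Eₖ; by the
  -- Satisfaction Condition M then satisfies Sen(γ)(Eₖ•).
  strong-transport : ModNonEmpty → ∀ {Σₖ Σ Σ'} {Eₖ : Pred (Sen Σₖ) ℓ} {E' : Pred (Sen Σ') ℓ}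
    (θ γ : Hom Σₖ Σ) (μ : Hom Σ Σ') → θ ≤ γ → ModMaximal (θ ⨾ μ) →
    IsStrong (Σₖ , Eₖ) (Σ' , E') (θ ⨾ μ) → ReductsSatisfy μ E' (SenImg γ (Eₖ •))
  strong-transport ne θ γ μ θ≤γ θμ-maximal θμ-strong M' M'⊨E' M M∈ ρ (ρₖ , ρₖ∈ , γρₖ≡ρ) =
    let (Mₖ , Mₖ∈γ) = ne γ M
        Mₖ∈θμ = mod-comp θ μ M' M Mₖ M∈ (mod-mono θ≤γ M Mₖ Mₖ∈γ)
        Mₖ⊨Eₖ = strong-reduct (θ ⨾ μ) θμ-maximal θμ-strong M' M'⊨E' Mₖ Mₖ∈θμ
    in proj₂ (satisfaction γ M Mₖ Mₖ∈γ ρₖ ρ γρₖ≡ρ) (ρₖ∈ Mₖ Mₖ⊨Eₖ)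

  -- The legs of the cocone are strong: a γ-reduct of a model of E is also a
  -- θ-reduct, and it satisfies Eₖ because Sen(γ)(Eₖ•) ⊆ E•.
  strong-leg : ModNonEmpty → ∀ {Σₖ Σ} {Eₖ : Pred (Sen Σₖ) ℓ} {E : Pred (Sen Σ) ℓ}
    (θ γ : Hom Σₖ Σ) → θ ≤ γ → SenTotal γ →
    SenImg γ (Eₖ •) ⊆ (E •) → IsStrong (Σₖ , Eₖ) (Σ , E) θ
  strong-leg ne {Eₖ = Eₖ} θ γ θ≤γ γ-total γEₖ•⊆E• M' M'⊨E =
    let (Mₖ , Mₖ∈γ) = ne γ M'
    in Mₖ , mod-mono θ≤γ M' Mₖ Mₖ∈γ , λ e e∈Eₖ →
         let (e' , γe≡e') = γ-total e
         in proj₁ (satisfaction γ M' Mₖ Mₖ∈γ e e' γe≡e')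
                  (γEₖ•⊆E• e' (e , ⊆-• Eₖ e e∈Eₖ , γe≡e') M' M'⊨E)

module TheoryPushouts {ℓ} (I : Inst ℓ) (𝒯 : Subcat (Inst.Sig I)) where
  open Inst I
  open Notions I
  open Subcat 𝒯
  open Pushouts I 𝒯

  lift-laxPushout : (P : ∀ T T' → ThHom T T' → Set ℓ) →
    ∀ {Σ₀ Σ₁ Σ₂ Σ} {E₀ : Pred (Sen Σ₀) ℓ} {E₁ : Pred (Sen Σ₁) ℓ}
      {E₂ : Pred (Sen Σ₂) ℓ} {E : Pred (Sen Σ) ℓ}
      {φ₁ : Hom Σ₀ Σ₁} {φ₂ : Hom Σ₀ Σ₂}
      {θ₀ : Hom Σ₀ Σ} {θ₁ : Hom Σ₁ Σ} {θ₂ : Hom Σ₂ Σ} →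
    SigPO.IsLaxPushout φ₁ φ₂ θ₀ θ₁ θ₂ →
    P (Σ₀ , E₀) (Σ , E) θ₀ → P (Σ₁ , E₁) (Σ , E) θ₁ → P (Σ₂ , E₂) (Σ , E) θ₂ →
    (∀ Σ' E' (μ : Hom Σ Σ') → In μ →
       P (Σ₀ , E₀) (Σ' , E') (θ₀ ⨾ μ) → P (Σ₁ , E₁) (Σ' , E') (θ₁ ⨾ μ) →
       P (Σ₂ , E₂) (Σ' , E') (θ₂ ⨾ μ) → P (Σ , E) (Σ' , E') μ) →
    LaxPO.IsLaxPushout Theory ThHom _⨾_ _≤_ (λ {T} {T'} φ → In φ × P T T' φ)
      {Σ₀ , E₀} {Σ₁ , E₁} {Σ₂ , E₂} {Σ , E} φ₁ φ₂ θ₀ θ₁ θ₂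
  lift-laxPushout P (cocone , in₀ , in₁ , in₂ , universal) p₀ p₁ p₂ mediate =
    cocone , (in₀ , p₀) , (in₁ , p₁) , (in₂ , p₂) , λ where
      (Σ' , E') θ₀' θ₁' θ₂' cocone' (in₀' , p₀') (in₁' , p₁') (in₂' , p₂') →
        let (μ , (inμ , e₀ , e₁ , e₂) , unique) =
              universal Σ' θ₀' θ₁' θ₂' cocone' in₀' in₁' in₂'
            pμ = mediate Σ' E' μ inμ (subst (P _ _) (sym e₀) p₀')
                   (subst (P _ _) (sym e₁) p₁') (subst (P _ _) (sym e₂) p₂')
        in μ , ((inμ , pμ) , e₀ , e₁ , e₂) , λ ν (inν , _) → unique ν inν

open InstitutionFacts
open TheoryPushouts

mainTheorem12 :
  ∀ {ℓ} (I : Inst ℓ) (𝒯 : Subcat (Inst.Sig I)) →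
  let open Inst I
      open Notions I
      open Subcat 𝒯
      open Pushouts I 𝒯
  in
  ∀ (Σ₀ Σ₁ Σ₂ Σ : Obj)
    (E₀ : Pred (Sen Σ₀) ℓ) (E₁ : Pred (Sen Σ₁) ℓ) (E₂ : Pred (Sen Σ₂) ℓ)
    (E : Pred (Sen Σ) ℓ)
    (φ₁ : Hom Σ₀ Σ₁) (φ₂ : Hom Σ₀ Σ₂)
    (θ₀ : Hom Σ₀ Σ) (θ₁ : Hom Σ₁ Σ) (θ₂ : Hom Σ₂ Σ) →
    SigPO.IsLaxCocone φ₁ φ₂ θ₀ θ₁ θ₂ →
    ModNonEmpty →
    SigPO.IsLaxPushout φ₁ φ₂ θ₀ θ₁ θ₂ →
    -- (a) weak case (γₖ = θₖ)
    (SenLax → SenOplax →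
     (∀ {A B} (f : Hom A B) → In f → SenMaximal f) →
     IsWeak (Σ₀ , E₀) (Σ₁ , E₁) φ₁ →
     IsWeak (Σ₀ , E₀) (Σ₂ , E₂) φ₂ →
     (SenImg θ₀ (E₀ •) ∪₃ SenImg θ₁ (E₁ •) ∪₃ SenImg θ₂ (E₂ •)) ⊆ (E •) →
     (E •) ≐ ((SenImg θ₀ (E₀ •) ∪₃ SenImg θ₁ (E₁ •) ∪₃ SenImg θ₂ (E₂ •)) •) →
     WeakPO.IsLaxPushout {Σ₀ , E₀} {Σ₁ , E₁} {Σ₂ , E₂} {Σ , E}
       φ₁ φ₂ θ₀ θ₁ θ₂)
    ×
    -- (b) strong case
    (∀ (γ₀ : Hom Σ₀ Σ) (γ₁ : Hom Σ₁ Σ) (γ₂ : Hom Σ₂ Σ) →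
     θ₀ ≤ γ₀ → θ₁ ≤ γ₁ → θ₂ ≤ γ₂ →
     SenTotal γ₀ → SenTotal γ₁ → SenTotal γ₂ →
     (∀ {A B} (f : Hom A B) → In f → ModMaximal f) →
     IsStrong (Σ₀ , E₀) (Σ₁ , E₁) φ₁ →
     IsStrong (Σ₀ , E₀) (Σ₂ , E₂) φ₂ →
     (SenImg γ₀ (E₀ •) ∪₃ SenImg γ₁ (E₁ •) ∪₃ SenImg γ₂ (E₂ •)) ⊆ (E •) →
     (E •) ≐ ((SenImg γ₀ (E₀ •) ∪₃ SenImg γ₁ (E₁ •) ∪₃ SenImg γ₂ (E₂ •)) •) →
     StrongPO.IsLaxPushout {Σ₀ , E₀} {Σ₁ , E₁} {Σ₂ , E₂} {Σ , E}
       φ₁ φ₂ θ₀ θ₁ θ₂)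
mainTheorem12 I 𝒯 Σ₀ Σ₁ Σ₂ Σ E₀ E₁ E₂ E φ₁ φ₂ θ₀ θ₁ θ₂ _ ne pushout =
  weak-case , strong-case
  where
  open Inst I
  open Notions I
  open Subcat 𝒯

  weak-case = λ lax _ sen-maximal _ _ legs⊆E• E•≐ →
    let (θ₀-weak , θ₁-weak , θ₂-weak) = ∪₃-⊆ I legs⊆E•
    in
    lift-laxPushout I 𝒯 IsWeak pushout θ₀-weak θ₁-weak θ₂-weak λ Σ' E' μ inμ w₀ w₁ w₂ →
        let μ-total = sen-maximal μ inμ
        in weak-by-reducts I ne μ (proj₁ E•≐)
             (reducts-∪₃ I (weak-transport I lax θ₀ μ μ-total w₀)
                           (weak-transport I lax θ₁ μ μ-total w₁)
                           (weak-transport I lax θ₂ μ μ-total w₂))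

  strong-case = λ γ₀ γ₁ γ₂ θ₀≤γ₀ θ₁≤γ₁ θ₂≤γ₂ γ₀-total γ₁-total γ₂-total
                  mod-maximal _ _ legs⊆E• E•≐ →
    let (_ , in₀ , in₁ , in₂ , _) = pushout
        (γ₀E₀⊆E• , γ₁E₁⊆E• , γ₂E₂⊆E•) = ∪₃-⊆ I legs⊆E•
        maximal-after : ∀ {Σₖ Σ'} {θ : Hom Σₖ Σ} {μ : Hom Σ Σ'} → In θ → In μ → ModMaximal (θ ⨾ μ)
        maximal-after inθ inμ = mod-maximal _ (⨾-in inθ inμ)
    in
    lift-laxPushout I 𝒯 IsStrong pushout
      (strong-leg I ne θ₀ γ₀ θ₀≤γ₀ γ₀-total γ₀E₀⊆E•)
      (strong-leg I ne θ₁ γ₁ θ₁≤γ₁ γ₁-total γ₁E₁⊆E•)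
      (strong-leg I ne θ₂ γ₂ θ₂≤γ₂ γ₂-total γ₂E₂⊆E•)
      λ Σ' E' μ inμ s₀ s₁ s₂ →
        strong-by-reducts I ne μ (proj₁ E•≐)
          (reducts-∪₃ I (strong-transport I ne θ₀ γ₀ μ θ₀≤γ₀ (maximal-after in₀ inμ) s₀)
                        (strong-transport I ne θ₁ γ₁ μ θ₁≤γ₁ (maximal-after in₁ inμ) s₁)
                        (strong-transport I ne θ₂ γ₂ μ θ₂≤γ₂ (maximal-after in₂ inμ) s₂))
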